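{- Let $G=(V,E)$ be a finite simple undirected graph with $n=|V|$, let $k$ be an integer with $0\le k\le n-1$, and consider the integer program $(F_E(k))$ defined in the context. Let $\{i,i'\}\in E$ and let $L_i,L_{i'}\subseteq\{1,\ldots,n\}$ be sets of labels such that $|\ell-\ell'|\le k$ for all $\ell\in L_i$ and $\ell'\in L_{i'}$. Then the inequality $$\sum_{\ell\in L_i}x^{\ell}_i+\sum_{\ell'\in L_{i'}}x^{\ell'}_{i'}\le 1$$ is valid for $(F_E(k))$, i.e., it is satisfied by every feasible solution of $(F_E(k))$.
   Context: For a graph $G=(V,E)$ with $n=|V|$ and an integer $k$, the feasibility integer program $(F_E(k))$ has binary variables $x^\ell_i\in\{0,1\}$ for $i\in V$, $\ell\in\{1,\ldots,n\}$ (meaning vertex $i$ receives label $\ell$) and constraints: $\sum_{i\in V}x^\ell_i=1$ for all $\ell\in\{1,\ldots,n\}$; $\sum_{\ell=1}^{n}x^\ell_i=1$ for all $i\in V$; and for every edge $\{i,i'\}\in E$ and every integer $\ell_2$ with $1\le\ell_2\le n-k$: $$\sum_{\ell_2\le\ell'\le\ell_2+k}\big(x^{\ell'}_i+x^{\ell'}_{i'}\big)\le 1.$$ An inequality is valid for $(F_E(k))$ if every $x$ satisfying all these constraints satisfies it. -}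

module Defs where

open import Data.Nat using (ℕ; zero; suc; _+_; _*_; _∸_; _≤_; _<_; _≤?_)
open import Data.Fin using (Fin; toℕ)
open import Data.Fin.Subset using (Subset; _∈_)
open import Data.Bool using (Bool; true; false; _∧_)
open import Data.Vec using (lookup)
open import Data.Sum using (_⊎_)
open import Relation.Nullary using (¬_)
open import Relation.Nullary.Decidable using (⌊_⌋)
open import Relation.Binary.PropositionalEquality using (_≡_)

sumFin : (n : ℕ) → (Fin n → ℕ) → ℕ
sumFin zero    f = 0
sumFin (suc n) f = f Fin.zero + sumFin n (λ i → f (Fin.suc i))

record SimpleGraph (n : ℕ) : Set₁ where
  field
    Adj       : Fin n → Fin n → Set
    symmetric : ∀ {i j} → Adj i j → Adj j i
    irreflex  : ∀ {i} → ¬ Adj i i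

-- Labels {1,…,n} are represented by Fin n: ℓ : Fin n stands for label toℕ ℓ + 1.
-- x i ℓ is the variable x^ℓ_i.
Assignment : ℕ → Set
Assignment n = Fin n → Fin n → ℕ

ind : Bool → ℕ
ind true  = 1
ind false = 0

absDiff : ℕ → ℕ → ℕ
absDiff a b = (a ∸ b) + (b ∸ a)

-- Σ_{ℓ₂ ≤ ℓ' ≤ ℓ₂ + k} x^ℓ'_i, with ℓ₂ given 1-based
windowSum : (n : ℕ) → Assignment n → Fin n → ℕ → ℕ → ℕ
windowSum n x i k ℓ₂ =
  sumFin n (λ ℓ → ind (⌊ ℓ₂ ≤? suc (toℕ ℓ) ⌋ ∧ ⌊ suc (toℕ ℓ) ≤? ℓ₂ + k ⌋) * x i ℓ)

subsetSum : (n : ℕ) → Assignment n → Fin n → Subset n → ℕ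
subsetSum n x i L = sumFin n (λ ℓ → ind (lookup L ℓ) * x i ℓ)

record Feasible (n : ℕ) (G : SimpleGraph n) (k : ℕ) (x : Assignment n) : Set where
  open SimpleGraph G
  field
    binary   : ∀ i ℓ → (x i ℓ ≡ 0) ⊎ (x i ℓ ≡ 1)
    labelOne : ∀ ℓ → sumFin n (λ i → x i ℓ) ≡ 1
    vertexOne : ∀ i → sumFin n (λ ℓ → x i ℓ) ≡ 1
    edgeWindow : ∀ i i' → Adj i i' → ∀ ℓ₂ → 1 ≤ ℓ₂ → ℓ₂ ≤ n ∸ k →
                 windowSum n x i k ℓ₂ + windowSum n x i' k ℓ₂ ≤ 1

module Submission where

-- If both sums were positive, vertex i would carry some label a ∈ Li and i' some
-- label b ∈ Li'. As |a − b| ≤ k, a single admissible window [ℓ₂, ℓ₂ + k] with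
-- 1 ≤ ℓ₂ ≤ n − k contains both a and b, so the edge constraint for that window is
-- violated. Each sum is at most 1 because a vertex receives exactly one label.

open import Defs
open import Data.Nat using (ℕ; zero; suc; _+_; _*_; _∸_; _≤_; _⊓_; _≤?_; z≤n; s≤s)
open import Data.Nat.Properties
open import Data.Fin using (Fin; toℕ)
open import Data.Fin.Properties using (toℕ≤pred[n])
open import Data.Fin.Subset using (Subset; _∈_)
open import Data.Bool using (true; false; _∧_)
open import Data.Vec using (lookup)
open import Data.Vec.Properties using (lookup⇒[]=)
open import Data.Product using (∃; _×_; _,_)
open import Data.Empty using (⊥)
open import Relation.Nullary.Decidable using (Dec; ⌊_⌋; isYes≗does; dec-true)
open import Relation.Binary.PropositionalEquality using (_≡_; refl; sym; trans; cong; cong₂; subst; module ≡-Reasoning)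

sumFin-mono : ∀ n {f g : Fin n → ℕ} → (∀ i → f i ≤ g i) → sumFin n f ≤ sumFin n g
sumFin-mono zero    f≤g = z≤n
sumFin-mono (suc n) f≤g = +-mono-≤ (f≤g Fin.zero) (sumFin-mono n (λ i → f≤g (Fin.suc i)))

≤-sumFin : ∀ n (f : Fin n → ℕ) (j : Fin n) → f j ≤ sumFin n f
≤-sumFin (suc n) f Fin.zero    = m≤m+n _ _
≤-sumFin (suc n) f (Fin.suc j) = ≤-trans (≤-sumFin n (λ i → f (Fin.suc i)) j) (m≤n+m _ _)

sumFin-positive : ∀ n (f : Fin n → ℕ) → 1 ≤ sumFin n f → ∃ λ j → 1 ≤ f j
sumFin-positive (suc n) f pos with f Fin.zero in f[0]≡
... | suc _ = Fin.zero , subst (1 ≤_) (sym f[0]≡) (s≤s z≤n)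
... | zero  with sumFin-positive n (λ i → f (Fin.suc i)) pos
...   | j , f[j]≥1 = Fin.suc j , f[j]≥1

ind*n≤n : ∀ b y → ind b * y ≤ y
ind*n≤n true  y = ≤-reflexive (*-identityˡ y)
ind*n≤n false y = z≤n

ind*n-positive : ∀ b y → 1 ≤ ind b * y → b ≡ true × 1 ≤ y
ind*n-positive true  y pos = refl , subst (1 ≤_) (*-identityˡ y) pos

subsetSum≤vertexSum : ∀ n (x : Assignment n) i L → subsetSum n x i L ≤ sumFin n (x i)
subsetSum≤vertexSum n x i L = sumFin-mono n (λ ℓ → ind*n≤n (lookup L ℓ) (x i ℓ))

subsetSum-positive : ∀ n (x : Assignment n) i L →
                     1 ≤ subsetSum n x i L → ∃ λ ℓ → ℓ ∈ L × 1 ≤ x i ℓ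
subsetSum-positive n x i L pos with sumFin-positive n _ pos
... | ℓ , term≥1 with ind*n-positive (lookup L ℓ) (x i ℓ) term≥1
...   | ℓ∈L , x≥1 = ℓ , lookup⇒[]= ℓ L ℓ∈L , x≥1

-- 0-based: the window [s, s + k] of label indices is the paper's window with ℓ₂ = s + 1.
Covers : ℕ → ℕ → ℕ → Set
Covers k s p = s ≤ p × p ≤ s + k

absDiff≤⇒≤+ : ∀ {a b k} → absDiff a b ≤ k → a ≤ b + k
absDiff≤⇒≤+ {a} {b} d = ≤-trans (m≤n+m∸n a b) (+-monoʳ-≤ b (≤-trans (m≤m+n _ _) d))

absDiff-comm : ∀ a b → absDiff a b ≡ absDiff b a
absDiff-comm a b = +-comm (a ∸ b) (b ∸ a)

-- The start is a ⊓ b, moved left to m ∸ k when the window would overrun m.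
commonWindow : ∀ {m k a b} → k ≤ m → a ≤ m → b ≤ m → absDiff a b ≤ k →
               ∃ λ s → s ≤ m ∸ k × Covers k s a × Covers k s b
commonWindow {m} {k} {a} {b} k≤m a≤m b≤m d =
  s , m⊓n≤n _ _ ,
  (≤-trans (m⊓n≤m _ _) (m⊓n≤m a b) , ≤end (m≤m+n a k) a≤b+k a≤m) ,
  (≤-trans (m⊓n≤m _ _) (m⊓n≤n a b) , ≤end b≤a+k (m≤m+n b k) b≤m)
  where
  s = a ⊓ b ⊓ (m ∸ k)
  a≤b+k = absDiff≤⇒≤+ d
  b≤a+k = absDiff≤⇒≤+ (subst (_≤ k) (absDiff-comm a b) d)
  end≡ : (a + k) ⊓ (b + k) ⊓ m ≡ s + k
  end≡ = begin
    (a + k) ⊓ (b + k) ⊓ m          ≡⟨ cong₂ _⊓_ (+-distribʳ-⊓ k a b) (m∸n+n≡m k≤m) ⟨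
    (a ⊓ b + k) ⊓ (m ∸ k + k)      ≡⟨ +-distribʳ-⊓ k (a ⊓ b) (m ∸ k) ⟨
    a ⊓ b ⊓ (m ∸ k) + k            ∎
    where open ≡-Reasoning
  ≤end : ∀ {p} → p ≤ a + k → p ≤ b + k → p ≤ m → p ≤ s + k
  ≤end p≤a+k p≤b+k p≤m = subst (_ ≤_) end≡ (⊓-glb (⊓-glb p≤a+k p≤b+k) p≤m)

⌊⌋≡true : ∀ {A : Set} (a? : Dec A) → A → ⌊ a? ⌋ ≡ true
⌊⌋≡true a? a = trans (isYes≗does a?) (dec-true a? a)

covers⇒≤windowSum : ∀ n (x : Assignment n) i k s (ℓ : Fin n) → Covers k s (toℕ ℓ) →
                    x i ℓ ≤ windowSum n x i k (suc s)
covers⇒≤windowSum n x i k s ℓ (s≤ℓ , ℓ≤s+k) =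
  subst (_≤ windowSum n x i k (suc s)) coefficient≡1 (≤-sumFin n _ ℓ)
  where
  coefficient≡1 : ind (⌊ suc s ≤? suc (toℕ ℓ) ⌋ ∧ ⌊ suc (toℕ ℓ) ≤? suc s + k ⌋) * x i ℓ ≡ x i ℓ
  coefficient≡1 = trans (cong (λ b → ind b * x i ℓ)
                               (cong₂ _∧_ (⌊⌋≡true (suc s ≤? _) (s≤s s≤ℓ))
                                          (⌊⌋≡true (_ ≤? suc s + k) (s≤s ℓ≤s+k))))
                        (*-identityˡ (x i ℓ))

exclusive⇒+≤1 : ∀ {s t} → s ≤ 1 → t ≤ 1 → (1 ≤ s → 1 ≤ t → ⊥) → s + t ≤ 1
exclusive⇒+≤1 {zero}          _   t≤1 _         = t≤1
exclusive⇒+≤1 {suc _} {zero}  s≤1 _   _         = subst (_≤ 1) (sym (+-identityʳ _)) s≤1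
exclusive⇒+≤1 {suc _} {suc _} _   _   notBoth with () ← notBoth (s≤s z≤n) (s≤s z≤n)

adjacent-labels-far : ∀ {n} {G : SimpleGraph n} {k x i i'} → Feasible n G k x →
                      k ≤ n ∸ 1 → SimpleGraph.Adj G i i' → ∀ a b →
                      1 ≤ x i a → 1 ≤ x i' b → absDiff (toℕ a) (toℕ b) ≤ k → ⊥
adjacent-labels-far {suc m} {k = k} {x} {i} {i'} F k≤m adj a b xa≥1 xb≥1 close
  with s , s≤m∸k , covers-a , covers-b ← commonWindow k≤m (toℕ≤pred[n] a) (toℕ≤pred[n] b) close
  = 1+n≰n (≤-trans (+-mono-≤ a-in-window b-in-window)
                    (Feasible.edgeWindow F i i' adj (suc s) (s≤s z≤n) start≤n∸k))
  where
  a-in-window : 1 ≤ windowSum (suc m) x i k (suc s)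
  a-in-window = ≤-trans xa≥1 (covers⇒≤windowSum (suc m) x i k s a covers-a)
  b-in-window : 1 ≤ windowSum (suc m) x i' k (suc s)
  b-in-window = ≤-trans xb≥1 (covers⇒≤windowSum (suc m) x i' k s b covers-b)
  start≤n∸k : suc s ≤ suc m ∸ k
  start≤n∸k = subst (suc s ≤_) (sym (+-∸-assoc 1 k≤m)) (s≤s s≤m∸k)

mainTheorem3 : (n : ℕ) (G : SimpleGraph n) (k : ℕ) → k ≤ n ∸ 1 →
    (i i' : Fin n) → SimpleGraph.Adj G i i' →
    (Li Li' : Subset n) →
    (∀ ℓ ℓ' → ℓ ∈ Li → ℓ' ∈ Li' → absDiff (toℕ ℓ) (toℕ ℓ') ≤ k) →
    (x : Assignment n) → Feasible n G k x →
    subsetSum n x i Li + subsetSum n x i' Li' ≤ 1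
mainTheorem3 n G k k≤n∸1 i i' adj Li Li' close x F =
  exclusive⇒+≤1 (subsetSum≤1 i Li) (subsetSum≤1 i' Li') notBoth
  where
  subsetSum≤1 : ∀ j L → subsetSum n x j L ≤ 1
  subsetSum≤1 j L = subst (subsetSum n x j L ≤_) (Feasible.vertexOne F j) (subsetSum≤vertexSum n x j L)
  notBoth : 1 ≤ subsetSum n x i Li → 1 ≤ subsetSum n x i' Li' → ⊥
  notBoth pos pos'
    with a , a∈Li , xa≥1 ← subsetSum-positive n x i Li pos
       | b , b∈Li' , xb≥1 ← subsetSum-positive n x i' Li' pos'
    = adjacent-labels-far F k≤n∸1 adj a b xa≥1 xb≥1 (close a b a∈Li b∈Li')
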